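{- Let $G$ be a graph without isolated vertices, and let $D$ be a minimal dynamo of $G$, meaning that for every $u\in D$ the set $D\setminus\{u\}$ is not a dynamo of $G$. Then $V(G)\setminus D$ is a dynamo of $G$. Moreover, if exactly the vertices of $V(G)\setminus D$ are black at time $0$, then all vertices of $G$ are black by time step $t=1$.
   Context: All graphs are finite and simple. In the irreversible majority conversion process on a graph $G$, every vertex is black or white at each discrete time step $t=0,1,2,\ldots$. A black vertex stays black forever. A white vertex $v$ of degree $\deg_G(v)\geq 1$ becomes black at time $t$ if at least $\deg_G(v)/2$ of its neighbors are black at time $t-1$. An isolated vertex never changes color. A dynamo of $G$ is a set $D\subseteq V(G)$ such that, if exactly the vertices of $D$ are black at time $0$, then every vertex of $G$ is eventually black. -}

module Defs where

open import Data.Nat using (ℕ; zero; suc; _+_; _*_; _≤_; _≤ᵇ_)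
open import Data.Bool using (Bool; true; false; _∧_; _∨_; not; if_then_else_)
open import Data.Fin using (Fin; zero; suc; _≟_)
open import Data.Product using (Σ; ∃; _×_)
open import Relation.Nullary using (¬_)
open import Relation.Nullary.Decidable using (⌊_⌋)
open import Relation.Binary.PropositionalEquality using (_≡_)

record Graph : Set where
  field
    n     : ℕ
    adj   : Fin n → Fin n → Bool
    sym   : ∀ u v → adj u v ≡ adj v u
    irrefl : ∀ v → adj v v ≡ false
open Graph public

count : ∀ {m} → (Fin m → Bool) → ℕ
count {zero}  p = 0
count {suc m} p = (if p zero then 1 else 0) + count (λ i → p (suc i))

-- A colouring / vertex subset: true = black / member.
VSet : Graph → Set
VSet G = Fin (n G) → Bool

deg : (G : Graph) → Fin (n G) → ℕ
deg G v = count (adj G v)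

blackNbrs : (G : Graph) → VSet G → Fin (n G) → ℕ
blackNbrs G B v = count (λ u → adj G v u ∧ B u)

-- one step of irreversible majority conversion:
-- black stays black; a white vertex of degree ≥ 1 becomes black iff
-- at least deg(v)/2 neighbours are black, i.e. deg v ≤ 2 * blackNbrs;
-- isolated vertices never change.
step : (G : Graph) → VSet G → VSet G
step G B v = B v ∨ ((1 ≤ᵇ deg G v) ∧ (deg G v ≤ᵇ 2 * blackNbrs G B v))

stateAt : (G : Graph) → VSet G → ℕ → VSet G
stateAt G D zero    = D
stateAt G D (suc t) = step G (stateAt G D t)

AllBlack : (G : Graph) → VSet G → Set
AllBlack G B = ∀ v → B v ≡ true

IsDynamo : (G : Graph) → VSet G → Set
IsDynamo G D = ∃ λ t → AllBlack G (stateAt G D t)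

remove : (G : Graph) → VSet G → Fin (n G) → VSet G
remove G D u v = D v ∧ not ⌊ v ≟ u ⌋

complement : (G : Graph) → VSet G → VSet G
complement G D v = not (D v)

IsMinimalDynamo : (G : Graph) → VSet G → Set
IsMinimalDynamo G D =
  IsDynamo G D × (∀ u → D u ≡ true → ¬ IsDynamo G (remove G D u))

NoIsolated : Graph → Set
NoIsolated G = ∀ v → 1 ≤ deg G v

-- Suppose some v ∈ D is not black after one step from V(G) ∖ D. Then fewer than
-- half of the neighbours of v lie outside D, so at least half lie in D ∖ {v}
-- (v is not its own neighbour), and one step from D ∖ {v} already blackens all
-- of D. The process is monotone, so D ∖ {v} would be a dynamo, contradicting
-- the minimality of D.
module Submission where

open import Defs hiding (sym)
open import Data.Bool using (Bool; true; false; _∧_; not) renaming (_≟_ to _≟ᵇ_)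
open import Data.Bool.Properties using (T-≡; ¬-not; ∧-identityʳ; ∨-zeroʳ)
open import Data.Fin using (Fin; zero; suc; _≟_)
open import Data.Nat using (ℕ; suc; _+_; _*_; _≤_; _<_; _≤ᵇ_; z≤n; s≤s)
open import Data.Nat.Properties
  using (≤⇒≤ᵇ; ≤ᵇ⇒≤; ≤-trans; n≤1+n; *-monoʳ-≤; +-identityʳ; +-monoʳ-≤;
         +-cancelʳ-<; +-suc; ≰⇒>; <⇒≤; _≤?_)
open import Data.Product using (_×_; _,_)
open import Data.Sum using (_⊎_; inj₁; inj₂)
open import Function using (_∘_; case_of_)
open import Function.Bundles using (Equivalence)
open import Relation.Nullary using (¬_; yes; no; contradiction)
open import Relation.Binary.PropositionalEquality
  using (_≡_; _≢_; refl; sym; trans; cong; subst)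

≤⇒≤ᵇ≡true : ∀ {m n} → m ≤ n → (m ≤ᵇ n) ≡ true
≤⇒≤ᵇ≡true = Equivalence.to T-≡ ∘ ≤⇒≤ᵇ

≤ᵇ≡true⇒≤ : ∀ {m n} → (m ≤ᵇ n) ≡ true → m ≤ n
≤ᵇ≡true⇒≤ {m} {n} = ≤ᵇ⇒≤ m n ∘ Equivalence.from T-≡

count-mono : ∀ {m} (p q : Fin m → Bool) → (∀ i → p i ≡ true → q i ≡ true) →
  count p ≤ count q
count-mono {ℕ.zero} p q p⇒q = z≤n
count-mono {suc m} p q p⇒q with p zero in p₀ | q zero in q₀
... | true  | true  = s≤s (count-mono _ _ (p⇒q ∘ suc))
... | false | true  = ≤-trans (count-mono _ _ (p⇒q ∘ suc)) (n≤1+n _)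
... | false | false = count-mono _ _ (p⇒q ∘ suc)
... | true  | false with () ← subst (_≡ false) (p⇒q zero p₀) q₀

count-cong : ∀ {m} (p q : Fin m → Bool) → (∀ i → p i ≡ q i) → count p ≡ count q
count-cong {ℕ.zero} p q p≡q = refl
count-cong {suc m} p q p≡q rewrite p≡q zero = cong (_ +_) (count-cong _ _ (p≡q ∘ suc))

count-∧-split : ∀ {m} (a b : Fin m → Bool) →
  count (λ i → a i ∧ b i) + count (λ i → a i ∧ not (b i)) ≡ count a
count-∧-split {ℕ.zero} a b = refl
count-∧-split {suc m} a b with a zero | b zero
... | true  | true  = cong suc (count-∧-split (a ∘ suc) (b ∘ suc))
... | true  | false = trans (+-suc _ _) (cong suc (count-∧-split (a ∘ suc) (b ∘ suc)))
... | false | true  = count-∧-split (a ∘ suc) (b ∘ suc)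
... | false | false = count-∧-split (a ∘ suc) (b ∘ suc)

majority-flip : ∀ {b c d} → b + c ≡ d → ¬ d ≤ 2 * c → d ≤ 2 * b
majority-flip {b} {c} refl b+c≰2c rewrite +-identityʳ b = +-monoʳ-≤ b (<⇒≤ c<b)
  where
  c<b : c < b
  c<b = +-cancelʳ-< c c b (subst (_< b + c) (cong (c +_) (+-identityʳ c)) (≰⇒> b+c≰2c))

module _ (G : Graph) where

  _⊆_ : VSet G → VSet G → Set
  A ⊆ B = ∀ v → A v ≡ true → B v ≡ true

  stays-black : ∀ {B v} → B v ≡ true → step G B v ≡ true
  stays-black {B} {v} black rewrite black = refl

  becomes-black : ∀ {B v} → 1 ≤ deg G v → deg G v ≤ 2 * blackNbrs G B v →
    step G B v ≡ true
  becomes-black {B} {v} 1≤deg majority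
    rewrite ≤⇒≤ᵇ≡true 1≤deg | ≤⇒≤ᵇ≡true majority = ∨-zeroʳ (B v)

  blackNbrs-mono : ∀ {A B} → A ⊆ B → ∀ v → blackNbrs G A v ≤ blackNbrs G B v
  blackNbrs-mono {A} {B} A⊆B v = count-mono _ _ adjacent-black
    where
    adjacent-black : ∀ u → (adj G v u ∧ A u) ≡ true → (adj G v u ∧ B u) ≡ true
    adjacent-black u _ with adj G v u | A u in Au
    adjacent-black u _ | true | true rewrite A⊆B u Au = refl

  step-black⇒ : ∀ {B v} → step G B v ≡ true →
    B v ≡ true ⊎ (1 ≤ deg G v × deg G v ≤ 2 * blackNbrs G B v)
  step-black⇒ {B} {v} _
    with B v | 1 ≤ᵇ deg G v in 1≤deg | deg G v ≤ᵇ 2 * blackNbrs G B v in majority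
  ... | true  | _    | _    = inj₁ refl
  ... | false | true | true = inj₂ (≤ᵇ≡true⇒≤ 1≤deg , ≤ᵇ≡true⇒≤ majority)

  step-mono : ∀ {A B} → A ⊆ B → step G A ⊆ step G B
  step-mono {A} {B} A⊆B v stepA with step-black⇒ stepA
  ... | inj₁ black = stays-black (A⊆B v black)
  ... | inj₂ (1≤deg , majority) =
    becomes-black 1≤deg (≤-trans majority (*-monoʳ-≤ 2 (blackNbrs-mono A⊆B v)))

  stateAt-⊆-step : ∀ {A B} → A ⊆ step G B → ∀ t → stateAt G A t ⊆ stateAt G B (suc t)
  stateAt-⊆-step A⊆stepB ℕ.zero    = A⊆stepB
  stateAt-⊆-step A⊆stepB (suc t) = step-mono (stateAt-⊆-step A⊆stepB t)

  isDynamo-⊆-step : ∀ {A B} → A ⊆ step G B → IsDynamo G A → IsDynamo G B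
  isDynamo-⊆-step A⊆stepB (t , black) = suc t , λ v → stateAt-⊆-step A⊆stepB t v (black v)

  blackNbrs-split : ∀ D v → blackNbrs G D v + blackNbrs G (complement G D) v ≡ deg G v
  blackNbrs-split D v = count-∧-split (adj G v) D

  blackNbrs-remove-self : ∀ D v → blackNbrs G (remove G D v) v ≡ blackNbrs G D v
  blackNbrs-remove-self D v = count-cong _ _ same
    where
    same : ∀ w → (adj G v w ∧ remove G D v w) ≡ (adj G v w ∧ D w)
    same w with w ≟ v
    ... | yes refl rewrite irrefl G w = refl
    ... | no _ with adj G v w | D w
    ...   | true  | d = ∧-identityʳ d
    ...   | false | _ = refl

  remove-other : ∀ {D u v} → v ≢ u → D v ≡ true → remove G D u v ≡ true
  remove-other {D} {u} {v} v≢u Dv with v ≟ u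
  ... | yes v≡u = contradiction v≡u v≢u
  ... | no _ rewrite Dv = refl

  ⊆-step-remove : NoIsolated G → ∀ {D u} → deg G u ≤ 2 * blackNbrs G D u →
    D ⊆ step G (remove G D u)
  ⊆-step-remove noIsolated {D} {u} majority v Dv = case v ≟ u of λ where
    (yes refl) → becomes-black (noIsolated v)
                   (subst (λ k → deg G v ≤ 2 * k) (sym (blackNbrs-remove-self D v)) majority)
    (no v≢u)   → stays-black (remove-other {D} v≢u Dv)

lemma1 : (G : Graph) → NoIsolated G → (D : VSet G) → IsMinimalDynamo G D →
    IsDynamo G (complement G D) × AllBlack G (stateAt G (complement G D) 1)
lemma1 G noIsolated D (dynamo , minimal) = (1 , blackAtOne) , blackAtOne
  where
  blackAtOne : AllBlack G (step G (complement G D))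
  blackAtOne v with D v ≟ᵇ true
  ... | no v∉D = stays-black G {complement G D} (cong not (¬-not v∉D))
  ... | yes v∈D with deg G v ≤? 2 * blackNbrs G (complement G D) v
  ...   | yes majorityOutside = becomes-black G (noIsolated v) majorityOutside
  ...   | no minorityOutside =
    contradiction (isDynamo-⊆-step G (⊆-step-remove G noIsolated {D} {v} majorityInside) dynamo)
                  (minimal v v∈D)
    where
    majorityInside : deg G v ≤ 2 * blackNbrs G D v
    majorityInside = majority-flip {blackNbrs G D v} (blackNbrs-split G D v) minorityOutside
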